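{- In a projective Q-structure, for any $A\subseteq\mathcal P$ and any facts $F,G$: $A\cdot F\subseteq F$, $G\otimes F\subseteq F$ and $F\subseteq G\wp F$.
   Context: A Q-structure is a tuple $\langle\mathcal P,\mathcal Z,\cdot,1\rangle$ with $\mathcal P$ a set, $\mathcal Z\subseteq\mathcal P$, $\cdot$ a binary operation on $\mathcal P$ (not assumed associative or commutative), and $1\in\mathcal P$. These satisfy, for all $x,y,z$: $x\cdot y\in\mathcal Z$ iff $y\cdot x\in\mathcal Z$; $(x\cdot y)\cdot z\in\mathcal Z$ iff $x\cdot(z\cdot y)\in\mathcal Z$; and $1\cdot x=x\cdot1=x$. It is projective if $x\cdot y\in\mathcal Z$ for every $x\in\mathcal Z$ and every $y\in\mathcal P$. For $A\subseteq\mathcal P$, $A^\perp=\{b: b\cdot a\in\mathcal Z\ \forall a\in A\}$. A fact is a subset $F$ with $F=(F^\perp)^\perp$. For $A,B\subseteq\mathcal P$, $A\cdot B=\{a\cdot b:a\in A,b\in B\}$. Operations on facts: $F\otimes G=((F\cdot G)^\perp)^\perp$ and $F\wp G=(F^\perp\cdot G^\perp)^\perp$. -}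

module Defs where

open import Level using (Level; suc)
open import Data.Product using (Σ; _×_; ∃)
open import Relation.Binary.PropositionalEquality using (_≡_)
open import Relation.Unary using (Pred; _∈_; _⊆_)
open import Function.Bundles using (_⇔_)

record QStructure (ℓ : Level) : Set (suc ℓ) where
  infixl 7 _∙_
  field
    Carrier : Set ℓ
    Z       : Pred Carrier ℓ
    _∙_     : Carrier → Carrier → Carrier
    one     : Carrier
    comm-Z  : ∀ x y → (x ∙ y ∈ Z) ⇔ (y ∙ x ∈ Z)
    assoc-Z : ∀ x y z → ((x ∙ y) ∙ z ∈ Z) ⇔ (x ∙ (z ∙ y) ∈ Z)
    identityˡ : ∀ x → one ∙ x ≡ x
    identityʳ : ∀ x → x ∙ one ≡ x

module QOps {ℓ : Level} (Q : QStructure ℓ) where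
  open QStructure Q

  Projective : Set ℓ
  Projective = ∀ x y → x ∈ Z → x ∙ y ∈ Z

  _⊥ : Pred Carrier ℓ → Pred Carrier ℓ
  (A ⊥) b = ∀ a → a ∈ A → b ∙ a ∈ Z

  IsFact : Pred Carrier ℓ → Set ℓ
  IsFact F = (F ⊆ ((F ⊥) ⊥)) × (((F ⊥) ⊥) ⊆ F)

  _·ˢ_ : Pred Carrier ℓ → Pred Carrier ℓ → Pred Carrier ℓ
  (A ·ˢ B) c = Σ Carrier λ a → Σ Carrier λ b → a ∈ A × b ∈ B × c ≡ a ∙ b

  _⊗_ : Pred Carrier ℓ → Pred Carrier ℓ → Pred Carrier ℓ
  F ⊗ G = ((F ·ˢ G) ⊥) ⊥

  _⅋_ : Pred Carrier ℓ → Pred Carrier ℓ → Pred Carrier ℓ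
  F ⅋ G = ((F ⊥) ·ˢ (G ⊥)) ⊥

{-# OPTIONS --safe #-}
module Submission where

open import Defs
open import Level using (Level)
open import Data.Product using (_×_; _,_)
open import Relation.Unary using (Pred; _∈_; _⊆_)
open import Relation.Binary.PropositionalEquality using (refl)
open import Function.Bundles using (Equivalence)

-- Projectivity lets an element be inserted next to the right factor of a
-- product in Z: from x·y ∈ Z get (x·y)·z ∈ Z, i.e. x·(z·y) ∈ Z.  So a·b lies
-- in B⊥⊥ for b ∈ B, and B lies in (A·B⊥)⊥, for arbitrary A and B; facts then
-- absorb A·F, and also G ⊗ F because ⊥⊥ is monotone.

module QProperties {ℓ : Level} (Q : QStructure ℓ) where
  open QStructure Q
  open QOps Q
  open Equivalence

  ⊥-antitone : {A B : Pred Carrier ℓ} → A ⊆ B → B ⊥ ⊆ A ⊥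
  ⊥-antitone A⊆B c∈B⊥ a a∈A = c∈B⊥ a (A⊆B a∈A)

  ⊥⊥-monotone : {A B : Pred Carrier ℓ} → A ⊆ B → (A ⊥) ⊥ ⊆ (B ⊥) ⊥
  ⊥⊥-monotone A⊆B = ⊥-antitone (⊥-antitone A⊆B)

  module _ (projective : Projective) where

    insert-Z : ∀ x y z → x ∙ y ∈ Z → x ∙ (z ∙ y) ∈ Z
    insert-Z x y z xy∈Z = to (assoc-Z x y z) (projective (x ∙ y) z xy∈Z)

    ·ˢ-⊆-⊥⊥ : {A B : Pred Carrier ℓ} → A ·ˢ B ⊆ (B ⊥) ⊥
    ·ˢ-⊆-⊥⊥ (a , b , _ , b∈B , refl) c c∈B⊥ =
      to (comm-Z c (a ∙ b)) (insert-Z c b a (c∈B⊥ b b∈B))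

    ⊆-⊥-·ˢ-⊥ : {A B : Pred Carrier ℓ} → B ⊆ (A ·ˢ (B ⊥)) ⊥
    ⊆-⊥-·ˢ-⊥ {x = b} b∈B _ (a , c , _ , c∈B⊥ , refl) =
      insert-Z b c a (to (comm-Z c b) (c∈B⊥ b b∈B))

    ·ˢ-absorbs-fact : {A F : Pred Carrier ℓ} → IsFact F → A ·ˢ F ⊆ F
    ·ˢ-absorbs-fact (_ , ⊥⊥F⊆F) x∈AF = ⊥⊥F⊆F (·ˢ-⊆-⊥⊥ x∈AF)

    ⊗-absorbs-fact : {G F : Pred Carrier ℓ} → IsFact F → G ⊗ F ⊆ F
    ⊗-absorbs-fact {G} factF@(_ , ⊥⊥F⊆F) x∈G⊗F =
      ⊥⊥F⊆F (⊥⊥-monotone (·ˢ-absorbs-fact {A = G} factF) x∈G⊗F)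

corollary2 : {ℓ : Level} (Q : QStructure ℓ) → QOps.Projective Q →
    (A F G : Pred (QStructure.Carrier Q) ℓ) → QOps.IsFact Q F → QOps.IsFact Q G →
      (QOps._·ˢ_ Q A F ⊆ F) × (QOps._⊗_ Q G F ⊆ F) × (F ⊆ QOps._⅋_ Q G F)
corollary2 Q projective A F G factF _ =
  ·ˢ-absorbs-fact projective {A} factF ,
  ⊗-absorbs-fact projective {G} factF ,
  ⊆-⊥-·ˢ-⊥ projective {QOps._⊥ Q G}
  where open QProperties Q
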